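{- Let $n\ge 1$ and $l\ge1$ be integers and let $r\ge 2l$ be an integer with $r^2\le l^3 n$. Let $\mathcal B$ be an $n$-uniform intersecting family with $|\mathcal B|=r$ such that any $l$ distinct members of $\mathcal B$ have empty intersection. Then $$c_n(\mathcal B)\le e^{ -\frac{r^2}{10 l^3 n}}.$$
   Context: A family is intersecting if any two members intersect, and $n$-uniform if all members have exactly $n$ elements. A cover of $\mathcal B$ is a set meeting every member of $\mathcal B$. A minimal cover is a cover none of whose proper subsets is a cover. With $n$ fixed, $\mathcal C(\mathcal B)$ is the family of all minimal covers $C$ of $\mathcal B$ with $|C|\le n$, and for $\lambda>0$, $c_\lambda(\mathcal B)=\sum_{C\in\mathcal C(\mathcal B)}\lambda^{ -|C|}$. -}

module Defs where

open import Data.Nat as ℕ using (ℕ; zero; suc)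
open import Data.Nat using (_!)
open import Data.Integer using (+_)
open import Data.Rational as ℚ using (ℚ; 0ℚ; 1ℚ)
open import Data.Fin using (Fin)
open import Data.Fin.Subset as Sub using (Subset; _∩_; Nonempty; Empty; ⋂; _⊂_; ∣_∣)
open import Data.List using (List; []; _∷_; length; map; sum)
open import Data.List.Membership.Propositional as L using ()
open import Data.List.Relation.Unary.All using (All)
open import Data.List.Relation.Unary.Unique.Propositional using (Unique)
open import Data.Product using (_×_)
open import Function.Bundles using (_⇔_)
open import Relation.Binary.PropositionalEquality using (_≡_)
open import Relation.Nullary using (¬_)

-- a finite family of subsets of the ground set Fin m, given as a list
-- (distinctness of members is imposed separately via Unique)
Family : ℕ → Set
Family m = List (Subset m)

Uniform : ∀ {m} → ℕ → Family m → Set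
Uniform n 𝓑 = ∀ A → A L.∈ 𝓑 → ∣ A ∣ ≡ n

Intersecting : ∀ {m} → Family m → Set
Intersecting 𝓑 = ∀ A B → A L.∈ 𝓑 → B L.∈ 𝓑 → Nonempty (A ∩ B)

LWiseEmpty : ∀ {m} → ℕ → Family m → Set
LWiseEmpty l 𝓑 = ∀ (S : List (Subset _)) → Unique S → length S ≡ l →
                 All (L._∈ 𝓑) S → Empty (⋂ S)

IsCover : ∀ {m} → Family m → Subset m → Set
IsCover 𝓑 C = ∀ A → A L.∈ 𝓑 → Nonempty (C ∩ A)

IsMinimalCover : ∀ {m} → Family m → Subset m → Set
IsMinimalCover 𝓑 C = IsCover 𝓑 C × (∀ D → D ⊂ C → ¬ IsCover 𝓑 D)

Enumerates𝒞 : ∀ {m} → ℕ → Family m → List (Subset m) → Set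
Enumerates𝒞 n 𝓑 𝒞s = Unique 𝒞s ×
  (∀ C → (C L.∈ 𝒞s) ⇔ (IsMinimalCover 𝓑 C × ∣ C ∣ ℕ.≤ n))

-- a / b as a rational (with a / 0 := 0; only used with b ≠ 0)
_//_ : ℕ → ℕ → ℚ
a // zero = 0ℚ
a // suc b = (+ a) ℚ./ suc b

sumℚ : List ℚ → ℚ
sumℚ [] = 0ℚ
sumℚ (x ∷ xs) = x ℚ.+ sumℚ xs

-- c_λ(𝓑) for natural λ, computed from an enumeration of 𝒞(𝓑):
-- sum over C of λ^{-|C|}
cλ : ∀ {m} → ℕ → List (Subset m) → ℚ
cλ λ' 𝒞s = sumℚ (map (λ C → 1 // (λ' ℕ.^ ∣ C ∣)) 𝒞s)

pow : ℚ → ℕ → ℚ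
pow x zero = 1ℚ
pow x (suc k) = x ℚ.* pow x k

expPartial : ℚ → ℕ → ℚ
expPartial x zero = 0ℚ
expPartial x (suc N) = expPartial x N ℚ.+ pow x N ℚ.* (1 // (N !))

{-# OPTIONS --safe #-}
-- Give each C ∈ 𝒞(𝓑) the weight n^(n-|C|), so that the total weight is n^n c_n(𝓑), and let
-- Ψ(X, H) be the weight of the covers C ⊇ X in which C counts twice if it meets every member of
-- the list H in at most one point. Starting from X = ∅ and H = [], take a member B missed by X
-- and branch over y ∈ B to (X ∪ {y}, B ∷ H). Every C meets B, so Ψ(X, H) is at most the sum
-- over the n children, and at a leaf X is a cover, hence the only minimal cover above itself.
-- A child keeps the factor two only if y lies in no earlier member: B meets all earlier
-- members and each point lies in fewer than l members, so with D = (l-2)n at most a fraction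
-- (D - |H|)/D of B qualifies. A cover has at least r/(l-1) points, so all leaves lie at depth
-- k or more when (l-1)(k-1) < r, which gives 2 c_n(𝓑) ≤ 1 + D(D-1)⋯(D-k+1)/D^k
-- ≤ 1 + 2D/(2D + k(k-1)). Taking also r ≤ (l-1)k turns this into c_n(𝓑) ≤ 1 - r²/(10 l³ n),
-- and (1 - x) Σ_{j<N} x^j/j! ≤ 1 for 0 ≤ x ≤ 1.

module Submission where

open import Defs
open import Function using (id; _∘_; _⇔_; Equivalence; case_of_)
open import Data.Nat
  using (ℕ; zero; suc; pred; _+_; _*_; _∸_; _^_; _≤_; _<_; _≤?_; z≤n; s≤s; NonZero; >-nonZero; >-nonZero⁻¹; _!)
open import Data.Nat.Properties
open import Data.Nat.ListAction using (sum)
open import Data.Nat.Combinatorics.Base using (_P′_)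
open import Data.Nat.Tactic.RingSolver using (solve-∀)
open import Data.Bool using (if_then_else_)
open import Data.Fin using (Fin; zero; suc)
open import Data.Fin.Subset
  using (Subset; inside; outside; _∈_; _∉_; _⊆_; _∩_; _∪_; ⁅_⁆; ⊥; ⋂; ∣_∣; Nonempty; Empty)
open import Data.Fin.Subset.Properties
  using (_∈?_; _⊆?_; x∈p∩q⁺; x∈p∩q⁻; x∈p∪q⁺; x∈p∪q⁻; x∈⁅x⁆; x∈⁅y⁆⇒x≡y; ∪-identityʳ; ∈⊤;
         p⊆q⇒∣p∣≤∣q∣; ∣⁅x⁆∣≡1; ⊆-antisym; ⊥⊆; p⊆p∪q; ∩-comm; nonempty?; Empty-unique; ∣⊥∣≡0; ∣p∣≤n)
open import Data.List using (List; []; _∷_; length; map; filter; take)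
open import Data.List.Properties using (map-cong; length-take)
open import Data.List.Membership.Propositional using (find) renaming (_∈_ to _∈ₗ_)
open import Data.List.Relation.Unary.Any using (here; there)
open import Data.List.Relation.Unary.All using (All; []; _∷_)
import Data.List.Relation.Unary.All as All
import Data.List.Relation.Unary.All.Properties as All
import Data.List.Relation.Unary.Unique.Propositional.Properties as Unique
open import Data.List.Relation.Unary.Unique.Propositional using (Unique)
open import Data.List.Relation.Unary.AllPairs using ([]; _∷_)
open import Data.Product using (∃; _×_; _,_; proj₁; proj₂)
open import Data.Sum using (_⊎_; inj₁; inj₂)
open import Data.Empty using (⊥-elim)
open import Data.Unit using (⊤; tt)
open import Relation.Nullary using (¬_; Dec; yes; no; does; contradiction)
open import Relation.Nullary.Decidable using (dec-true; dec-false)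
open import Relation.Binary.PropositionalEquality
  using (_≡_; refl; sym; trans; cong; cong₂; subst; subst₂; module ≡-Reasoning)
open import Data.Vec.Base using ([]; _∷_)
import Data.Vec.Base as Vec
import Data.Integer as ℤ
import Data.Integer.Properties as ℤ
open import Data.Rational using (ℚ; 0ℚ; 1ℚ)
import Data.Rational as ℚ
import Data.Rational.Properties as ℚ
import Data.Rational.Unnormalised as ℚᵘ
import Data.Rational.Unnormalised.Properties as ℚᵘ
open import Data.Rational.Solver using (module +-*-Solver)
open +-*-Solver using (solve; _:=_; _:+_; _:*_; _:-_; con)
open import Algebra.Properties.CommutativeSemigroup +-commutativeSemigroup
  using () renaming (interchange to +-interchange)
open import Algebra.Properties.CommutativeSemigroup *-commutativeSemigroup
  using (xy∙z≈xz∙y; xy∙z≈y∙xz; x∙yz≈y∙xz)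

-- Finite sums and indicators

∑ : ∀ {k} → Subset k → (Fin k → ℕ) → ℕ
∑ []            f = 0
∑ (inside ∷ p)  f = f zero + ∑ p (f ∘ suc)
∑ (outside ∷ p) f = ∑ p (f ∘ suc)

syntax ∑ p (λ y → e) = ∑[ y ∈ p ] e

∑-cong : ∀ {k} (p : Subset k) {f g : Fin k → ℕ} → (∀ i → f i ≡ g i) → ∑ p f ≡ ∑ p g
∑-cong []            f≗g = refl
∑-cong (inside ∷ p)  f≗g = cong₂ _+_ (f≗g zero) (∑-cong p (f≗g ∘ suc))
∑-cong (outside ∷ p) f≗g = ∑-cong p (f≗g ∘ suc)

∑-mono-≤ : ∀ {k} (p : Subset k) {f g : Fin k → ℕ} → (∀ {i} → i ∈ p → f i ≤ g i) → ∑ p f ≤ ∑ p g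
∑-mono-≤ []            f≤g = z≤n
∑-mono-≤ (inside ∷ p)  f≤g = +-mono-≤ (f≤g Vec.here) (∑-mono-≤ p (f≤g ∘ Vec.there))
∑-mono-≤ (outside ∷ p) f≤g = ∑-mono-≤ p (f≤g ∘ Vec.there)

∑-distrib-+ : ∀ {k} (p : Subset k) (f g : Fin k → ℕ) → ∑[ i ∈ p ] (f i + g i) ≡ ∑ p f + ∑ p g
∑-distrib-+ []            f g = refl
∑-distrib-+ (inside ∷ p)  f g = begin
  (f zero + g zero) + ∑[ i ∈ p ] (f (suc i) + g (suc i))
    ≡⟨ cong ((f zero + g zero) +_) (∑-distrib-+ p (f ∘ suc) (g ∘ suc)) ⟩
  (f zero + g zero) + (∑ p (f ∘ suc) + ∑ p (g ∘ suc))
    ≡⟨ +-interchange (f zero) (g zero) _ _ ⟩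
  (f zero + ∑ p (f ∘ suc)) + (g zero + ∑ p (g ∘ suc)) ∎
  where open ≡-Reasoning
∑-distrib-+ (outside ∷ p) f g = ∑-distrib-+ p (f ∘ suc) (g ∘ suc)

∑-*ˡ : ∀ {k} (p : Subset k) (c : ℕ) (f : Fin k → ℕ) → ∑[ i ∈ p ] (c * f i) ≡ c * ∑ p f
∑-*ˡ []            c f = sym (*-zeroʳ c)
∑-*ˡ (inside ∷ p)  c f = trans (cong (c * f zero +_) (∑-*ˡ p c (f ∘ suc))) (sym (*-distribˡ-+ c (f zero) _))
∑-*ˡ (outside ∷ p) c f = ∑-*ˡ p c (f ∘ suc)

∑-const : ∀ {k} (p : Subset k) (c : ℕ) → ∑[ _ ∈ p ] c ≡ c * ∣ p ∣
∑-const []            c = sym (*-zeroʳ c)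
∑-const (inside ∷ p)  c = trans (cong (c +_) (∑-const p c)) (sym (*-suc c ∣ p ∣))
∑-const (outside ∷ p) c = ∑-const p c

∑-sum-comm : ∀ {k} {A : Set} (p : Subset k) (L : List A) (g : A → Fin k → ℕ) →
             ∑[ i ∈ p ] sum (map (λ a → g a i) L) ≡ sum (map (λ a → ∑ p (g a)) L)
∑-sum-comm p []      g = ∑-const p 0
∑-sum-comm p (a ∷ L) g = trans (∑-distrib-+ p (g a) _) (cong (∑ p (g a) +_) (∑-sum-comm p L g))

sum-map-mono-≤ : ∀ {A : Set} (L : List A) {f g : A → ℕ} → (∀ {a} → a ∈ₗ L → f a ≤ g a) →
                 sum (map f L) ≤ sum (map g L)
sum-map-mono-≤ []      f≤g = z≤n
sum-map-mono-≤ (a ∷ L) f≤g = +-mono-≤ (f≤g (here refl)) (sum-map-mono-≤ L (f≤g ∘ there))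

sum-map-*ˡ : ∀ {A : Set} (L : List A) (c : ℕ) (f : A → ℕ) → sum (map (λ a → c * f a) L) ≡ c * sum (map f L)
sum-map-*ˡ []      c f = sym (*-zeroʳ c)
sum-map-*ˡ (a ∷ L) c f = trans (cong (c * f a +_) (sum-map-*ˡ L c f)) (sym (*-distribˡ-+ c (f a) _))

length≤sum-map : ∀ {A : Set} (L : List A) (f : A → ℕ) → (∀ {a} → a ∈ₗ L → 1 ≤ f a) → length L ≤ sum (map f L)
length≤sum-map []      f 1≤f = z≤n
length≤sum-map (a ∷ L) f 1≤f = +-mono-≤ (1≤f (here refl)) (length≤sum-map L f (1≤f ∘ there))

𝟙 : ∀ {a} {A : Set a} → Dec A → ℕ
𝟙 A? = if does A? then 1 else 0

𝟙≤1 : ∀ {a} {A : Set a} (A? : Dec A) → 𝟙 A? ≤ 1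
𝟙≤1 (yes _) = s≤s z≤n
𝟙≤1 (no _)  = z≤n

𝟙-yes : ∀ {a} {A : Set a} (A? : Dec A) → A → 𝟙 A? ≡ 1
𝟙-yes A? x rewrite dec-true A? x = refl

𝟙-no : ∀ {a} {A : Set a} (A? : Dec A) → ¬ A → 𝟙 A? ≡ 0
𝟙-no A? ¬x rewrite dec-false A? ¬x = refl

𝟙-mono : ∀ {a b} {A : Set a} {B : Set b} (A? : Dec A) (B? : Dec B) → (A → B) → 𝟙 A? ≤ 𝟙 B?
𝟙-mono (no _)  B?      A→B = z≤n
𝟙-mono (yes x) (yes _) A→B = ≤-refl
𝟙-mono (yes x) (no ¬y) A→B = contradiction (A→B x) ¬y

𝟙-× : ∀ {a b c} {A : Set a} {B : Set b} {C : Set c} (A? : Dec A) (B? : Dec B) (C? : Dec C) →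
      A ⇔ (B × C) → 𝟙 A? ≡ 𝟙 B? * 𝟙 C?
𝟙-× (yes x) (yes _) (yes _) A⇔B×C = refl
𝟙-× (yes x) (yes _) (no ¬z) A⇔B×C = contradiction (proj₂ (Equivalence.to A⇔B×C x)) ¬z
𝟙-× (yes x) (no ¬y) C?      A⇔B×C = contradiction (proj₁ (Equivalence.to A⇔B×C x)) ¬y
𝟙-× (no ¬x) (yes y) (yes z) A⇔B×C = contradiction (Equivalence.from A⇔B×C (y , z)) ¬x
𝟙-× (no ¬x) (yes _) (no _)  A⇔B×C = refl
𝟙-× (no ¬x) (no _)  C?      A⇔B×C = refl

module _ {A : Set} {P : A → Set} (P? : ∀ a → Dec (P a)) (f : A → ℕ) where

  sum-𝟙*-none : ∀ {L} → (∀ {a} → a ∈ₗ L → ¬ P a) → sum (map (λ a → 𝟙 (P? a) * f a) L) ≡ 0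
  sum-𝟙*-none {[]}    ¬P = refl
  sum-𝟙*-none {a ∷ L} ¬P = cong₂ _+_ (cong (_* f a) (𝟙-no (P? a) (¬P (here refl)))) (sum-𝟙*-none (¬P ∘ there))

  sum-𝟙*-unique : ∀ {L x b} → Unique L → (∀ {a} → a ∈ₗ L → P a → a ≡ x) → (x ∈ₗ L → f x ≤ b) →
                  sum (map (λ a → 𝟙 (P? a) * f a) L) ≤ b
  sum-𝟙*-unique {[]}    _           _    _ = z≤n
  sum-𝟙*-unique {a ∷ L} (a∉L ∷ uL) P⇒≡x fx≤b with P? a
  ... | no  _  = sum-𝟙*-unique uL (P⇒≡x ∘ there) (fx≤b ∘ there)
  ... | yes Pa = begin
    1 * f a + sum (map (λ a → 𝟙 (P? a) * f a) L) ≡⟨ cong (1 * f a +_) (sum-𝟙*-none ¬P-rest) ⟩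
    1 * f a + 0                                  ≡⟨ trans (+-identityʳ _) (*-identityˡ _) ⟩
    f a                                          ≤⟨ subst (λ z → f z ≤ _) (sym a≡x) (fx≤b (subst (_∈ₗ _) a≡x (here refl))) ⟩
    _                                            ∎
    where
    open ≤-Reasoning
    a≡x = P⇒≡x (here refl) Pa
    ¬P-rest : ∀ {a′} → a′ ∈ₗ L → ¬ P a′
    ¬P-rest a′∈L Pa′ = All.lookup a∉L a′∈L (trans a≡x (sym (P⇒≡x (there a′∈L) Pa′)))

-- Subsets of a finite set

module _ {k : ℕ} where

  Nonempty⇒1≤∣p∣ : {p : Subset k} → Nonempty p → 1 ≤ ∣ p ∣
  Nonempty⇒1≤∣p∣ {p} (x , x∈p) =
    subst (_≤ ∣ p ∣) (∣⁅x⁆∣≡1 x) (p⊆q⇒∣p∣≤∣q∣ λ y∈⁅x⁆ → subst (_∈ p) (sym (x∈⁅y⁆⇒x≡y x y∈⁅x⁆)) x∈p)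

  1≤∣p∣⇒Nonempty : {p : Subset k} → 1 ≤ ∣ p ∣ → Nonempty p
  1≤∣p∣⇒Nonempty {p} 1≤∣p∣ with nonempty? p
  ... | yes ne = ne
  ... | no ¬ne = contradiction (trans (cong ∣_∣ (Empty-unique ¬ne)) (∣⊥∣≡0 k)) (>⇒≢ 1≤∣p∣)

  ⊆⇒∣∩∣≤ : {p q : Subset k} (r : Subset k) → p ⊆ q → ∣ p ∩ r ∣ ≤ ∣ q ∩ r ∣
  ⊆⇒∣∩∣≤ {p} {q} r p⊆q = p⊆q⇒∣p∣≤∣q∣ λ x∈p∩r →
    let (x∈p , x∈r) = x∈p∩q⁻ p r x∈p∩r in x∈p∩q⁺ (p⊆q x∈p , x∈r)

  p∪⁅x⁆⊆q⇔ : {p q : Subset k} {x : Fin k} → p ∪ ⁅ x ⁆ ⊆ q ⇔ (p ⊆ q × x ∈ q)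
  p∪⁅x⁆⊆q⇔ {p} {q} {x} = record
    { to   = λ p∪x⊆q → p∪x⊆q ∘ x∈p∪q⁺ ∘ inj₁ , p∪x⊆q (x∈p∪q⁺ (inj₂ (x∈⁅x⁆ x)))
    ; from = λ (p⊆q , x∈q) y∈ → case x∈p∪q⁻ p ⁅ x ⁆ y∈ of λ where
        (inj₁ y∈p) → p⊆q y∈p
        (inj₂ y∈x) → subst (_∈ q) (sym (x∈⁅y⁆⇒x≡y x y∈x)) x∈q
    ; to-cong = λ { refl → refl }
    ; from-cong = λ { refl → refl }
    }

  Empty[p∩q]⇒x∈q⇒x∉p : {p q : Subset k} {x : Fin k} → Empty (p ∩ q) → x ∈ q → x ∉ p
  Empty[p∩q]⇒x∈q⇒x∉p p∩q≡∅ x∈q x∈p = p∩q≡∅ (_ , x∈p∩q⁺ (x∈p , x∈q))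

  x∈⋂⁺ : {x : Fin k} {ps : List (Subset k)} → All (x ∈_) ps → x ∈ ⋂ ps
  x∈⋂⁺ []           = ∈⊤
  x∈⋂⁺ (x∈p ∷ x∈ps) = x∈p∩q⁺ (x∈p , x∈⋂⁺ x∈ps)

∣p∩q∣≡∑𝟙 : ∀ {k} (p q : Subset k) → ∣ p ∩ q ∣ ≡ ∑[ y ∈ q ] 𝟙 (y ∈? p)
∣p∩q∣≡∑𝟙 []            []            = refl
∣p∩q∣≡∑𝟙 (inside ∷ p)  (inside ∷ q)  = cong suc (∣p∩q∣≡∑𝟙 p q)
∣p∩q∣≡∑𝟙 (outside ∷ p) (inside ∷ q)  = ∣p∩q∣≡∑𝟙 p q
∣p∩q∣≡∑𝟙 (inside ∷ p)  (outside ∷ q) = ∣p∩q∣≡∑𝟙 p q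
∣p∩q∣≡∑𝟙 (outside ∷ p) (outside ∷ q) = ∣p∩q∣≡∑𝟙 p q

∣p∪⁅x⁆∣≡1+∣p∣ : ∀ {k} (p : Subset k) {x} → x ∉ p → ∣ p ∪ ⁅ x ⁆ ∣ ≡ suc ∣ p ∣
∣p∪⁅x⁆∣≡1+∣p∣ (inside ∷ p)  {zero}  x∉p = contradiction Vec.here x∉p
∣p∪⁅x⁆∣≡1+∣p∣ (outside ∷ p) {zero}  x∉p = cong (suc ∘ ∣_∣) (∪-identityʳ p)
∣p∪⁅x⁆∣≡1+∣p∣ (inside ∷ p)  {suc x} x∉p = cong suc (∣p∪⁅x⁆∣≡1+∣p∣ p (x∉p ∘ Vec.there))
∣p∪⁅x⁆∣≡1+∣p∣ (outside ∷ p) {suc x} x∉p = ∣p∪⁅x⁆∣≡1+∣p∣ p (x∉p ∘ Vec.there)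

∣[p∪⁅x⁆]∩q∣≡∣p∩q∣+𝟙 : ∀ {k} (p q : Subset k) {x} → x ∉ p → ∣ (p ∪ ⁅ x ⁆) ∩ q ∣ ≡ ∣ p ∩ q ∣ + 𝟙 (x ∈? q)
∣[p∪⁅x⁆]∩q∣≡∣p∩q∣+𝟙 (inside ∷ p)  q             {zero}  x∉p = contradiction Vec.here x∉p
∣[p∪⁅x⁆]∩q∣≡∣p∩q∣+𝟙 (outside ∷ p) (inside ∷ q)  {zero}  x∉p =
  trans (cong (λ r → suc ∣ r ∩ q ∣) (∪-identityʳ p)) (+-comm 1 _)
∣[p∪⁅x⁆]∩q∣≡∣p∩q∣+𝟙 (outside ∷ p) (outside ∷ q) {zero}  x∉p =
  trans (cong (λ r → ∣ r ∩ q ∣) (∪-identityʳ p)) (sym (+-identityʳ _))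
∣[p∪⁅x⁆]∩q∣≡∣p∩q∣+𝟙 (inside ∷ p)  (inside ∷ q)  {suc x} x∉p = cong suc (∣[p∪⁅x⁆]∩q∣≡∣p∩q∣+𝟙 p q (x∉p ∘ Vec.there))
∣[p∪⁅x⁆]∩q∣≡∣p∩q∣+𝟙 (inside ∷ p)  (outside ∷ q) {suc x} x∉p = ∣[p∪⁅x⁆]∩q∣≡∣p∩q∣+𝟙 p q (x∉p ∘ Vec.there)
∣[p∪⁅x⁆]∩q∣≡∣p∩q∣+𝟙 (outside ∷ p) (inside ∷ q)  {suc x} x∉p = ∣[p∪⁅x⁆]∩q∣≡∣p∩q∣+𝟙 p q (x∉p ∘ Vec.there)
∣[p∪⁅x⁆]∩q∣≡∣p∩q∣+𝟙 (outside ∷ p) (outside ∷ q) {suc x} x∉p = ∣[p∪⁅x⁆]∩q∣≡∣p∩q∣+𝟙 p q (x∉p ∘ Vec.there)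

deg : ∀ {k} → List (Subset k) → Fin k → ℕ
deg L y = sum (map (λ s → 𝟙 (y ∈? s)) L)

∑deg≡sum∣∩∣ : ∀ {k} (L : List (Subset k)) (X : Subset k) →
              ∑[ y ∈ X ] deg L y ≡ sum (map (λ A → ∣ A ∩ X ∣) L)
∑deg≡sum∣∩∣ L X = trans (∑-sum-comm X L (λ s y → 𝟙 (y ∈? s))) (sym (cong sum (map-cong (λ A → ∣p∩q∣≡∑𝟙 A X) L)))

deg≡length-filter : ∀ {k} (L : List (Subset k)) (y : Fin k) → deg L y ≡ length (filter (y ∈?_) L)
deg≡length-filter []      y = refl
deg≡length-filter (s ∷ L) y with y ∈? s
... | yes _ = cong suc (deg≡length-filter L y)
... | no _  = deg≡length-filter L y

1≤deg⇒∃∈ : ∀ {k} (L : List (Subset k)) y → 1 ≤ deg L y → ∃ λ s → s ∈ₗ L × y ∈ s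
1≤deg⇒∃∈ (s ∷ L) y 1≤deg with y ∈? s
... | yes y∈s = s , here refl , y∈s
... | no  _   = let (s′ , s′∈L , y∈s′) = 1≤deg⇒∃∈ L y 1≤deg in s′ , there s′∈L , y∈s′

-- Families and their covers

minimal-cover-⊇-cover⇒≡ : ∀ {m} {𝓑 : Family m} {C X} → IsMinimalCover 𝓑 C → IsCover 𝓑 X → X ⊆ C → X ≡ C
minimal-cover-⊇-cover⇒≡ {X = X} (_ , minimal) X-cover X⊆C = ⊆-antisym X⊆C C⊆X
  where
  C⊆X : _ ⊆ X
  C⊆X {x} x∈C with x ∈? X
  ... | yes x∈X = x∈X
  ... | no  x∉X = contradiction X-cover (minimal X (X⊆C , x , x∈C , x∉X))

cover⊎missed : ∀ {m} (𝓑 : Family m) X → IsCover 𝓑 X ⊎ ∃ λ B → B ∈ₗ 𝓑 × Empty (X ∩ B)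
cover⊎missed 𝓑 X with All.all? (λ A → nonempty? (X ∩ A)) 𝓑
... | yes X-meets-all = inj₁ (λ A A∈𝓑 → All.lookup X-meets-all A∈𝓑)
... | no  ¬X-meets-all = inj₂ (find (All.¬All⇒Any¬ (λ A → nonempty? (X ∩ A)) 𝓑 ¬X-meets-all))

module _ {m l} {𝓑 : Family m} (lw : LWiseEmpty l 𝓑) where

  deg<l : ∀ {L} → Unique L → All (_∈ₗ 𝓑) L → ∀ y → deg L y < l
  deg<l {L} uL L⊆𝓑 y with l ≤? deg L y
  ... | no  l≰deg = ≰⇒> l≰deg
  ... | yes l≤deg = ⊥-elim (lw S (Unique.take⁺ l (Unique.filter⁺ (y ∈?_) uL)) ∣S∣≡l
                       (All.take⁺ l (All.filter⁺ (y ∈?_) L⊆𝓑)) (y , x∈⋂⁺ (All.take⁺ l (All.all-filter (y ∈?_) L))))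
    where
    S = take l (filter (y ∈?_) L)
    ∣S∣≡l : length S ≡ l
    ∣S∣≡l = trans (length-take l _) (m≤n⇒m⊓n≡m (subst (l ≤_) (deg≡length-filter L y) l≤deg))

LWiseEmpty⇒3≤l : ∀ {m l} {𝓑 : Family m} → Unique 𝓑 → Intersecting 𝓑 → LWiseEmpty l 𝓑 → 2 ≤ length 𝓑 → 3 ≤ l
LWiseEmpty⇒3≤l {l = l} {A ∷ A′ ∷ 𝓑} ((A≢ ∷ _) ∷ _) intersecting lw _ =
  subst (_< l) (cong₂ (λ a a′ → a + (a′ + 0)) (𝟙-yes (y ∈? A) y∈A) (𝟙-yes (y ∈? A′) y∈A′))
    (deg<l lw ((A≢ ∷ []) ∷ [] ∷ []) (here refl ∷ there (here refl) ∷ []) y)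
  where
  y = proj₁ (intersecting A A′ (here refl) (there (here refl)))
  y∈A∩A′ = proj₂ (intersecting A A′ (here refl) (there (here refl)))
  y∈A = proj₁ (x∈p∩q⁻ A A′ y∈A∩A′)
  y∈A′ = proj₂ (x∈p∩q⁻ A A′ y∈A∩A′)
LWiseEmpty⇒3≤l {𝓑 = []}     _ _ _ ()
LWiseEmpty⇒3≤l {𝓑 = _ ∷ []} _ _ _ (s≤s ())

-- Natural-number estimates

m<n⇒m≤n∸1 : ∀ {m n} → m < n → m ≤ n ∸ 1
m<n⇒m≤n∸1 {n = suc n} (s≤s m≤n) = m≤n

c*[1∸d]+d≤c : ∀ c d → d ≤ c → c * (1 ∸ d) + d ≤ c
c*[1∸d]+d≤c c zero    _   = ≤-reflexive (trans (+-identityʳ _) (*-identityʳ c))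
c*[1∸d]+d≤c c (suc d) d≤c rewrite 0∸n≡0 d | *-zeroʳ c = d≤c

aP′[1+k]≡a*[a∸1]P′k : ∀ a k → a P′ suc k ≡ a * ((a ∸ 1) P′ k)
aP′[1+k]≡a*[a∸1]P′k a zero    = refl
aP′[1+k]≡a*[a∸1]P′k a (suc k) = begin
  (a ∸ suc k) * (a P′ suc k)               ≡⟨ cong ((a ∸ suc k) *_) (aP′[1+k]≡a*[a∸1]P′k a k) ⟩
  (a ∸ suc k) * (a * ((a ∸ 1) P′ k))       ≡⟨ x∙yz≈y∙xz (a ∸ suc k) a _ ⟩
  a * ((a ∸ suc k) * ((a ∸ 1) P′ k))       ≡⟨ cong (λ e → a * (e * ((a ∸ 1) P′ k))) (sym (∸-+-assoc a 1 k)) ⟩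
  a * ((a ∸ 1 ∸ k) * ((a ∸ 1) P′ k))       ∎
  where open ≡-Reasoning

[a∸i]*[A+2i]≤a*A : ∀ a i A → 2 * a ≤ A → (a ∸ i) * (A + 2 * i) ≤ a * A
[a∸i]*[A+2i]≤a*A a i A 2a≤A with i ≤? a
... | no  i≰a rewrite m≤n⇒m∸n≡0 (<⇒≤ (≰⇒> i≰a)) = z≤n
... | yes i≤a = begin
  (a ∸ i) * (A + 2 * i)                 ≡⟨ x*[A+2i]≡x*A+2x*i (a ∸ i) i A ⟩
  (a ∸ i) * A + 2 * (a ∸ i) * i         ≤⟨ +-monoʳ-≤ ((a ∸ i) * A) (*-monoˡ-≤ i 2[a∸i]≤A) ⟩
  (a ∸ i) * A + A * i                   ≡⟨ cong ((a ∸ i) * A +_) (*-comm A i) ⟩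
  (a ∸ i) * A + i * A                   ≡⟨ sym (*-distribʳ-+ A (a ∸ i) i) ⟩
  (a ∸ i + i) * A                       ≡⟨ cong (_* A) (m∸n+n≡m i≤a) ⟩
  a * A                                 ∎
  where
  open ≤-Reasoning
  x*[A+2i]≡x*A+2x*i : ∀ x i A → x * (A + 2 * i) ≡ x * A + 2 * x * i
  x*[A+2i]≡x*A+2x*i = solve-∀
  2[a∸i]≤A : 2 * (a ∸ i) ≤ A
  2[a∸i]≤A = ≤-trans (*-monoʳ-≤ 2 (m∸n≤m a i)) 2a≤A

aP′k*[2a+k[k∸1]]≤2a*aᵏ : ∀ a k → (a P′ k) * (2 * a + k * (k ∸ 1)) ≤ 2 * a * a ^ k
aP′k*[2a+k[k∸1]]≤2a*aᵏ a zero    = ≤-reflexive (base a)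
  where
  base : ∀ a → 1 * (2 * a + 0 * 0) ≡ 2 * a * 1
  base = solve-∀
aP′k*[2a+k[k∸1]]≤2a*aᵏ a (suc i) = begin
  (a ∸ i) * (a P′ i) * (2 * a + suc i * i)              ≡⟨ cong (λ e → (a ∸ i) * (a P′ i) * (2 * a + e)) ([1+i]*i≡i*[i∸1]+2i i) ⟩
  (a ∸ i) * (a P′ i) * (2 * a + (i * (i ∸ 1) + 2 * i))  ≡⟨ regroup (a P′ i) (a ∸ i) (2 * a) (i * (i ∸ 1)) (2 * i) ⟩
  (a P′ i) * ((a ∸ i) * ((2 * a + i * (i ∸ 1)) + 2 * i)) ≤⟨ *-monoʳ-≤ (a P′ i) ([a∸i]*[A+2i]≤a*A a i _ (m≤m+n _ _)) ⟩
  (a P′ i) * (a * (2 * a + i * (i ∸ 1)))                ≡⟨ x∙yz≈y∙xz (a P′ i) a _ ⟩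
  a * ((a P′ i) * (2 * a + i * (i ∸ 1)))                ≤⟨ *-monoʳ-≤ a (aP′k*[2a+k[k∸1]]≤2a*aᵏ a i) ⟩
  a * (2 * a * a ^ i)                                 ≡⟨ x∙yz≈y∙xz a (2 * a) (a ^ i) ⟩
  2 * a * (a * a ^ i)                                 ∎
  where
  open ≤-Reasoning
  [1+i]*i≡i*[i∸1]+2i : ∀ i → suc i * i ≡ i * (i ∸ 1) + 2 * i
  [1+i]*i≡i*[i∸1]+2i zero    = refl
  [1+i]*i≡i*[i∸1]+2i (suc i) = identity i
    where
    identity : ∀ i → suc (suc i) * suc i ≡ suc i * i + 2 * suc i
    identity = solve-∀
  regroup : ∀ p e x y z → (e * p) * (x + (y + z)) ≡ p * (e * ((x + y) + z))
  regroup = solve-∀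

bracket-by-multiples : ∀ a r → 1 ≤ a → 1 ≤ r → ∃ λ k → a * k < r × r ≤ a * suc k
bracket-by-multiples a (suc zero)    1≤a _ =
  0 , subst (_< 1) (sym (*-zeroʳ a)) (s≤s z≤n) , subst (1 ≤_) (sym (*-identityʳ a)) 1≤a
bracket-by-multiples a (suc (suc r)) 1≤a _ with bracket-by-multiples a (suc r) 1≤a (s≤s z≤n)
... | k , ak<1+r , 1+r≤a[1+k] with suc (suc r) ≤? a * suc k
...   | yes 2+r≤a[1+k] = k , m<n⇒m<1+n ak<1+r , 2+r≤a[1+k]
...   | no  2+r≰a[1+k] = suc k , ≰⇒> 2+r≰a[1+k] ,
          ≤-trans (+-mono-≤ 1≤a 1+r≤a[1+k]) (≤-reflexive (sym (*-suc a (suc k))))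

choose-depth : ∀ {l r} → 3 ≤ l → l < r → ∃ λ k → 1 ≤ k × (l ∸ 1) * k < r × r ≤ (l ∸ 1) * suc k
choose-depth {l} {r} 3≤l l<r
  with bracket-by-multiples (l ∸ 1) r (≤-trans (s≤s z≤n) (m<n⇒m≤n∸1 3≤l)) (≤-trans (s≤s z≤n) l<r)
... | suc k , [l∸1]k<r , r≤[l∸1][1+k] = suc k , s≤s z≤n , [l∸1]k<r , r≤[l∸1][1+k]
... | zero  , _        , r≤[l∸1]*1    =
  contradiction (≤-trans r≤[l∸1]*1 (≤-trans (≤-reflexive (*-identityʳ (l ∸ 1))) (m∸n≤m l 1))) (<⇒≱ l<r)

-- 10 = 8 + 2: using (k+1)² ≤ 2(k+1)k, the 2(l-2)n summand costs 8l³n(k+1)k and the (k+1)k summand 2l³n(k+1)k.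
constant-10-suffices : ∀ l n r k → 1 ≤ k → r ≤ (l ∸ 1) * suc k → r * r ≤ l ^ 3 * n →
                       2 * (r * r) * (2 * ((l ∸ 2) * n) + suc k * k) ≤ (10 * l ^ 3 * n) * (suc k * k)
constant-10-suffices l n r k 1≤k r≤[l∸1][1+k] r²≤l³n = begin
  2 * (r * r) * (2 * ((l ∸ 2) * n) + suc k * k)         ≡⟨ expand (r * r) (l ∸ 2) n (suc k * k) ⟩
  4 * (r * r) * ((l ∸ 2) * n) + 2 * (r * r) * (suc k * k)
      ≤⟨ +-mono-≤ 4r²D≤8l³nkk (*-monoˡ-≤ (suc k * k) (*-monoʳ-≤ 2 r²≤l³n)) ⟩
  8 * l ^ 3 * n * (suc k * k) + 2 * (l ^ 3 * n) * (suc k * k) ≡⟨ collect (l ^ 3) n (suc k * k) ⟩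
  (10 * l ^ 3 * n) * (suc k * k)                        ∎
  where
  open ≤-Reasoning
  expand : ∀ R d n q → 2 * R * (2 * (d * n) + q) ≡ 4 * R * (d * n) + 2 * R * q
  expand = solve-∀
  collect : ∀ L n q → 8 * L * n * q + 2 * (L * n) * q ≡ (10 * L * n) * q
  collect = solve-∀
  [1+k]²≤2[1+k]k : suc k * suc k ≤ 2 * (suc k * k)
  [1+k]²≤2[1+k]k = begin
    suc k * suc k            ≡⟨ *-suc (suc k) k ⟩
    suc k + suc k * k        ≤⟨ +-monoˡ-≤ (suc k * k) (m≤m*n (suc k) k {{>-nonZero 1≤k}}) ⟩
    suc k * k + suc k * k    ≡⟨ cong (suc k * k +_) (sym (+-identityʳ _)) ⟩
    2 * (suc k * k)          ∎
  [l∸2][l∸1]²≤l³ : (l ∸ 2) * ((l ∸ 1) * (l ∸ 1)) ≤ l ^ 3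
  [l∸2][l∸1]²≤l³ = *-mono-≤ (m∸n≤m l 2)
    (≤-trans (*-mono-≤ (m∸n≤m l 1) (m∸n≤m l 1)) (≤-reflexive (cong (l *_) (sym (*-identityʳ l)))))
  4r²D≤8l³nkk : 4 * (r * r) * ((l ∸ 2) * n) ≤ 8 * l ^ 3 * n * (suc k * k)
  4r²D≤8l³nkk = begin
    4 * (r * r) * ((l ∸ 2) * n)
      ≤⟨ *-monoˡ-≤ ((l ∸ 2) * n) (*-monoʳ-≤ 4 (*-mono-≤ r≤[l∸1][1+k] r≤[l∸1][1+k])) ⟩
    4 * (((l ∸ 1) * suc k) * ((l ∸ 1) * suc k)) * ((l ∸ 2) * n) ≡⟨ regroup (l ∸ 1) (l ∸ 2) (suc k) n ⟩
    4 * n * ((l ∸ 2) * ((l ∸ 1) * (l ∸ 1))) * (suc k * suc k)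
      ≤⟨ *-mono-≤ (*-monoʳ-≤ (4 * n) [l∸2][l∸1]²≤l³) [1+k]²≤2[1+k]k ⟩
    4 * n * l ^ 3 * (2 * (suc k * k))                         ≡⟨ regroup′ n (l ^ 3) (suc k * k) ⟩
    8 * l ^ 3 * n * (suc k * k)                               ∎
    where
    regroup : ∀ a b c n → 4 * ((a * c) * (a * c)) * (b * n) ≡ 4 * n * (b * (a * a)) * (c * c)
    regroup = solve-∀
    regroup′ : ∀ n L q → 4 * n * L * (2 * q) ≡ 8 * L * n * q
    regroup′ = solve-∀

-- Cross-multiplied: W/N ≤ (1 + P/E)/2 and P/E ≤ 2d/(2d + kk) give W/N ≤ 1 - kk/(2(2d + kk)).
halve-by-falling-factorial : ∀ E W N P d kk .{{_ : NonZero E}} →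
  E * (W * 2) ≤ N * (E + P) → P * (2 * d + kk) ≤ 2 * d * E →
  2 * (2 * d + kk) * W + N * kk ≤ 2 * (2 * d + kk) * N
halve-by-falling-factorial E W N P d kk root falling = *-cancelˡ-≤ E (begin
  E * (2 * Q * W + N * kk)                  ≡⟨ split E W N Q kk ⟩
  Q * (E * (W * 2)) + N * kk * E            ≤⟨ +-monoˡ-≤ (N * kk * E) (*-monoʳ-≤ Q root) ⟩
  Q * (N * (E + P)) + N * kk * E            ≡⟨ split′ E N P Q kk ⟩
  N * (Q * E + kk * E) + N * (P * Q)        ≤⟨ +-monoʳ-≤ (N * (Q * E + kk * E)) (*-monoʳ-≤ N falling) ⟩
  N * (Q * E + kk * E) + N * (2 * d * E)    ≡⟨ join E N d kk ⟩
  E * (2 * Q * N)                           ∎)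
  where
  open ≤-Reasoning
  Q = 2 * d + kk
  split : ∀ E W N Q kk → E * (2 * Q * W + N * kk) ≡ Q * (E * (W * 2)) + N * kk * E
  split = solve-∀
  split′ : ∀ E N P Q kk → Q * (N * (E + P)) + N * kk * E ≡ N * (Q * E + kk * E) + N * (P * Q)
  split′ = solve-∀
  join : ∀ E N d kk → N * ((2 * d + kk) * E + kk * E) + N * (2 * d * E) ≡ E * (2 * (2 * d + kk) * N)
  join = solve-∀

-- Cross-multiplied: W/N ≤ 1 - kk/(2Q) and rr/a ≤ kk/(2Q) give W/N + rr/a ≤ 1.
trade-for-exponent : ∀ Q W N kk rr a .{{_ : NonZero Q}} →
  2 * Q * W + N * kk ≤ 2 * Q * N → 2 * rr * Q ≤ a * kk → a * W + N * rr ≤ a * N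
trade-for-exponent Q W N kk rr a halved rr≤ = *-cancelˡ-≤ (2 * Q) {{m*n≢0 2 Q}} (begin
  2 * Q * (a * W + N * rr)            ≡⟨ split Q W N rr a ⟩
  a * (2 * Q * W) + N * (2 * rr * Q)  ≤⟨ +-monoʳ-≤ (a * (2 * Q * W)) (*-monoʳ-≤ N rr≤) ⟩
  a * (2 * Q * W) + N * (a * kk)      ≡⟨ split′ Q W N kk a ⟩
  a * (2 * Q * W + N * kk)            ≤⟨ *-monoʳ-≤ a halved ⟩
  a * (2 * Q * N)                     ≡⟨ swap Q N a ⟩
  2 * Q * (a * N)                     ∎)
  where
  open ≤-Reasoning
  split : ∀ Q W N rr a → 2 * Q * (a * W + N * rr) ≡ a * (2 * Q * W) + N * (2 * rr * Q)
  split = solve-∀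
  split′ : ∀ Q W N kk a → a * (2 * Q * W) + N * (a * kk) ≡ a * (2 * Q * W + N * kk)
  split′ = solve-∀
  swap : ∀ Q N a → a * (2 * Q * N) ≡ 2 * Q * (a * N)
  swap = solve-∀

-- Rational estimates

fromℕ : ℕ → ℚ
fromℕ zero    = 0ℚ
fromℕ (suc a) = 1ℚ ℚ.+ fromℕ a

fromℕ≡a/1 : ∀ a → fromℕ a ≡ ℤ.+ a ℚ./ 1
fromℕ≡a/1 zero    = sym (ℚ.0/n≡0 1)
fromℕ≡a/1 (suc a) = ℚ.toℚᵘ-injective (begin
  ℚ.toℚᵘ (1ℚ ℚ.+ fromℕ a)                ≈⟨ ℚ.toℚᵘ-homo-+ 1ℚ (fromℕ a) ⟩
  ℚ.toℚᵘ 1ℚ ℚᵘ.+ ℚ.toℚᵘ (fromℕ a)        ≈⟨ ℚᵘ.+-congʳ (ℚ.toℚᵘ 1ℚ) (ℚ.toℚᵘ-cong (fromℕ≡a/1 a)) ⟩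
  ℚ.toℚᵘ 1ℚ ℚᵘ.+ ℚ.toℚᵘ (ℤ.+ a ℚ./ 1)      ≈⟨ ℚᵘ.+-congʳ (ℚ.toℚᵘ 1ℚ) (ℚ.toℚᵘ-fromℚᵘ (ℚᵘ.mkℚᵘ (ℤ.+ a) 0)) ⟩
  ℚ.toℚᵘ 1ℚ ℚᵘ.+ ℚᵘ.mkℚᵘ (ℤ.+ a) 0         ≈⟨ ℚᵘ.*≡* (trans (ℤ.*-identityʳ _)
                                              (trans (cong (ℤ._+_ (ℤ.+ 1)) (ℤ.*-identityʳ (ℤ.+ a))) (sym (ℤ.*-identityʳ (ℤ.+ suc a))))) ⟩
  ℚᵘ.mkℚᵘ (ℤ.+ suc a) 0                   ≈⟨ ℚᵘ.≃-sym (ℚ.toℚᵘ-fromℚᵘ (ℚᵘ.mkℚᵘ (ℤ.+ suc a) 0)) ⟩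
  ℚ.toℚᵘ (ℤ.+ suc a ℚ./ 1)                ∎)
  where open ℚᵘ.≃-Reasoning

fromℕ-+ : ∀ a b → fromℕ (a + b) ≡ fromℕ a ℚ.+ fromℕ b
fromℕ-+ zero    b = sym (ℚ.+-identityˡ (fromℕ b))
fromℕ-+ (suc a) b = trans (cong (1ℚ ℚ.+_) (fromℕ-+ a b)) (sym (ℚ.+-assoc 1ℚ (fromℕ a) (fromℕ b)))

fromℕ-* : ∀ a b → fromℕ (a * b) ≡ fromℕ a ℚ.* fromℕ b
fromℕ-* zero    b = sym (ℚ.*-zeroˡ (fromℕ b))
fromℕ-* (suc a) b = begin
  fromℕ (b + a * b)                     ≡⟨ fromℕ-+ b (a * b) ⟩
  fromℕ b ℚ.+ fromℕ (a * b)             ≡⟨ cong (fromℕ b ℚ.+_) (fromℕ-* a b) ⟩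
  fromℕ b ℚ.+ fromℕ a ℚ.* fromℕ b       ≡⟨ cong (ℚ._+ fromℕ a ℚ.* fromℕ b) (sym (ℚ.*-identityˡ (fromℕ b))) ⟩
  1ℚ ℚ.* fromℕ b ℚ.+ fromℕ a ℚ.* fromℕ b ≡⟨ sym (ℚ.*-distribʳ-+ (fromℕ b) 1ℚ (fromℕ a)) ⟩
  (1ℚ ℚ.+ fromℕ a) ℚ.* fromℕ b           ∎
  where open ≡-Reasoning

0≤fromℕ : ∀ a → 0ℚ ℚ.≤ fromℕ a
0≤fromℕ zero    = ℚ.≤-refl
0≤fromℕ (suc a) = ℚ.+-mono-≤ (ℚ.nonNegative⁻¹ 1ℚ) (0≤fromℕ a)

fromℕ-mono-≤ : ∀ {a b} → a ≤ b → fromℕ a ℚ.≤ fromℕ b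
fromℕ-mono-≤ {a} {b} a≤b = begin
  fromℕ a                     ≡⟨ sym (ℚ.+-identityʳ (fromℕ a)) ⟩
  fromℕ a ℚ.+ 0ℚ              ≤⟨ ℚ.+-monoʳ-≤ (fromℕ a) (0≤fromℕ (b ∸ a)) ⟩
  fromℕ a ℚ.+ fromℕ (b ∸ a)    ≡⟨ sym (fromℕ-+ a (b ∸ a)) ⟩
  fromℕ (a + (b ∸ a))          ≡⟨ cong fromℕ (m+[n∸m]≡n a≤b) ⟩
  fromℕ b                      ∎
  where open ℚ.≤-Reasoning

fromℕ-pos : ∀ a .{{_ : NonZero a}} → ℚ.Positive (fromℕ a)
fromℕ-pos (suc a) = ℚ.pos+nonNeg⇒pos 1ℚ (fromℕ a) {{ℚ.nonNegative (0≤fromℕ a)}}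

a//d*d≡a : ∀ a d .{{_ : NonZero d}} → (a // d) ℚ.* fromℕ d ≡ fromℕ a
a//d*d≡a a (suc d) = ℚ.toℚᵘ-injective (begin
  ℚ.toℚᵘ ((ℤ.+ a ℚ./ suc d) ℚ.* fromℕ (suc d))            ≈⟨ ℚ.toℚᵘ-homo-* (ℤ.+ a ℚ./ suc d) (fromℕ (suc d)) ⟩
  ℚ.toℚᵘ (ℤ.+ a ℚ./ suc d) ℚᵘ.* ℚ.toℚᵘ (fromℕ (suc d))    ≈⟨ ℚᵘ.*-congˡ {ℚ.toℚᵘ (ℤ.+ a ℚ./ suc d)} (ℚ.toℚᵘ-cong (fromℕ≡a/1 (suc d))) ⟩
  ℚ.toℚᵘ (ℤ.+ a ℚ./ suc d) ℚᵘ.* ℚ.toℚᵘ (ℤ.+ suc d ℚ./ 1)    ≈⟨ ℚᵘ.*-cong (ℚ.toℚᵘ-fromℚᵘ (ℚᵘ.mkℚᵘ (ℤ.+ a) d))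
                                                                   (ℚ.toℚᵘ-fromℚᵘ (ℚᵘ.mkℚᵘ (ℤ.+ suc d) 0)) ⟩
  ℚᵘ.mkℚᵘ (ℤ.+ a) d ℚᵘ.* ℚᵘ.mkℚᵘ (ℤ.+ suc d) 0               ≈⟨ ℚᵘ.*≡* (ℤ.*-assoc (ℤ.+ a) (ℤ.+ suc d) (ℤ.+ 1)) ⟩
  ℚᵘ.mkℚᵘ (ℤ.+ a) 0                                       ≈⟨ ℚᵘ.≃-sym (ℚ.toℚᵘ-fromℚᵘ (ℚᵘ.mkℚᵘ (ℤ.+ a) 0)) ⟩
  ℚ.toℚᵘ (ℤ.+ a ℚ./ 1)                                    ≈⟨ ℚ.toℚᵘ-cong (sym (fromℕ≡a/1 a)) ⟩
  ℚ.toℚᵘ (fromℕ a)                                      ∎)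
  where open ℚᵘ.≃-Reasoning

0≤a//d : ∀ a d → 0ℚ ℚ.≤ a // d
0≤a//d a zero    = ℚ.≤-refl
0≤a//d a (suc d) = ℚ.nonNegative⁻¹ _ {{ℚ.normalize-nonNeg a (suc d)}}

a//d≤1 : ∀ {a} d .{{_ : NonZero d}} → a ≤ d → a // d ℚ.≤ 1ℚ
a//d≤1 {a} d a≤d = ℚ.*-cancelʳ-≤-pos (fromℕ d) {{fromℕ-pos d}} (begin
  (a // d) ℚ.* fromℕ d    ≡⟨ a//d*d≡a a d ⟩
  fromℕ a                 ≤⟨ fromℕ-mono-≤ a≤d ⟩
  fromℕ d                 ≡⟨ sym (ℚ.*-identityˡ (fromℕ d)) ⟩
  1ℚ ℚ.* fromℕ d          ∎)
  where open ℚ.≤-Reasoning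

module _ {x : ℚ} (0≤x : 0ℚ ℚ.≤ x) where

  0≤pow : ∀ k → 0ℚ ℚ.≤ pow x k
  0≤pow zero    = ℚ.nonNegative⁻¹ 1ℚ
  0≤pow (suc k) = ℚ.nonNegative⁻¹ _
    {{ℚ.nonNeg*nonNeg⇒nonNeg x {{ℚ.nonNegative 0≤x}} (pow x k) {{ℚ.nonNegative (0≤pow k)}}}}

  0≤expPartial : ∀ N → 0ℚ ℚ.≤ expPartial x N
  0≤expPartial zero    = ℚ.≤-refl
  0≤expPartial (suc N) = ℚ.+-mono-≤ (0≤expPartial N) (ℚ.nonNegative⁻¹ _
    {{ℚ.nonNeg*nonNeg⇒nonNeg (pow x N) {{ℚ.nonNegative (0≤pow N)}} (1 // (N !)) {{ℚ.nonNegative (0≤a//d 1 (N !))}}}})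

  module _ (x≤1 : x ℚ.≤ 1ℚ) where

    private
      0≤1-x : 0ℚ ℚ.≤ 1ℚ ℚ.- x
      0≤1-x = subst (ℚ._≤ 1ℚ ℚ.- x) (ℚ.+-inverseʳ x) (ℚ.+-monoˡ-≤ (ℚ.- x) x≤1)

    -- As 1/k! ≤ 1, this follows from (1 - x) (1 + x + ⋯ + x^(N-1)) = 1 - x^N.
    expPartial*[1-x]+pow≤1 : ∀ N → expPartial x N ℚ.* (1ℚ ℚ.- x) ℚ.+ pow x N ℚ.≤ 1ℚ
    expPartial*[1-x]+pow≤1 zero = ℚ.≤-reflexive (solve 1 (λ y → con 0ℚ :* (con 1ℚ :- y) :+ con 1ℚ := con 1ℚ) refl x)
    expPartial*[1-x]+pow≤1 (suc N) = begin
      (E ℚ.+ p ℚ.* c) ℚ.* (1ℚ ℚ.- x) ℚ.+ x ℚ.* p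
        ≡⟨ solve 4 (λ E p c x → (E :+ p :* c) :* (con 1ℚ :- x) :+ x :* p
                              := E :* (con 1ℚ :- x) :+ (p :* (con 1ℚ :- x)) :* c :+ x :* p) refl E p c x ⟩
      E ℚ.* (1ℚ ℚ.- x) ℚ.+ (p ℚ.* (1ℚ ℚ.- x)) ℚ.* c ℚ.+ x ℚ.* p
        ≤⟨ ℚ.+-monoˡ-≤ (x ℚ.* p) (ℚ.+-monoʳ-≤ (E ℚ.* (1ℚ ℚ.- x))
             (ℚ.*-monoˡ-≤-nonNeg (p ℚ.* (1ℚ ℚ.- x)) {{p*[1-x]≥0}} (a//d≤1 (N !) {{N !≢0}} (1≤n! N)))) ⟩
      E ℚ.* (1ℚ ℚ.- x) ℚ.+ (p ℚ.* (1ℚ ℚ.- x)) ℚ.* 1ℚ ℚ.+ x ℚ.* p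
        ≡⟨ solve 3 (λ E p x → E :* (con 1ℚ :- x) :+ (p :* (con 1ℚ :- x)) :* con 1ℚ :+ x :* p
                            := E :* (con 1ℚ :- x) :+ p) refl E p x ⟩
      E ℚ.* (1ℚ ℚ.- x) ℚ.+ p
        ≤⟨ expPartial*[1-x]+pow≤1 N ⟩
      1ℚ ∎
      where
      open ℚ.≤-Reasoning
      E = expPartial x N
      p = pow x N
      c = 1 // (N !)
      p*[1-x]≥0 = ℚ.nonNeg*nonNeg⇒nonNeg p {{ℚ.nonNegative (0≤pow N)}} (1ℚ ℚ.- x) {{ℚ.nonNegative 0≤1-x}}

    ≤1-x⇒*expPartial≤1 : ∀ {c} → c ℚ.≤ 1ℚ ℚ.- x → ∀ N → c ℚ.* expPartial x N ℚ.≤ 1ℚ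
    ≤1-x⇒*expPartial≤1 {c} c≤1-x N = begin
      c ℚ.* E                          ≤⟨ ℚ.*-monoʳ-≤-nonNeg E {{ℚ.nonNegative (0≤expPartial N)}} c≤1-x ⟩
      (1ℚ ℚ.- x) ℚ.* E                 ≡⟨ ℚ.*-comm (1ℚ ℚ.- x) E ⟩
      E ℚ.* (1ℚ ℚ.- x)                 ≡⟨ sym (ℚ.+-identityʳ _) ⟩
      E ℚ.* (1ℚ ℚ.- x) ℚ.+ 0ℚ          ≤⟨ ℚ.+-monoʳ-≤ (E ℚ.* (1ℚ ℚ.- x)) (0≤pow N) ⟩
      E ℚ.* (1ℚ ℚ.- x) ℚ.+ pow x N     ≤⟨ expPartial*[1-x]+pow≤1 N ⟩
      1ℚ                               ∎
      where
      open ℚ.≤-Reasoning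
      E = expPartial x N

1//nᵍ*nⁿ≡nⁿ⁻ᵍ : ∀ n .{{_ : NonZero n}} {g} → g ≤ n → (1 // (n ^ g)) ℚ.* fromℕ (n ^ n) ≡ fromℕ (n ^ (n ∸ g))
1//nᵍ*nⁿ≡nⁿ⁻ᵍ n {g} g≤n = begin
  (1 // (n ^ g)) ℚ.* fromℕ (n ^ n)                          ≡⟨ cong (λ e → (1 // (n ^ g)) ℚ.* fromℕ (n ^ e)) (sym (m+[n∸m]≡n g≤n)) ⟩
  (1 // (n ^ g)) ℚ.* fromℕ (n ^ (g + (n ∸ g)))              ≡⟨ cong (λ e → (1 // (n ^ g)) ℚ.* fromℕ e) (^-distribˡ-+-* n g (n ∸ g)) ⟩
  (1 // (n ^ g)) ℚ.* fromℕ (n ^ g * n ^ (n ∸ g))            ≡⟨ cong ((1 // (n ^ g)) ℚ.*_) (fromℕ-* (n ^ g) (n ^ (n ∸ g))) ⟩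
  (1 // (n ^ g)) ℚ.* (fromℕ (n ^ g) ℚ.* fromℕ (n ^ (n ∸ g))) ≡⟨ sym (ℚ.*-assoc (1 // (n ^ g)) _ _) ⟩
  ((1 // (n ^ g)) ℚ.* fromℕ (n ^ g)) ℚ.* fromℕ (n ^ (n ∸ g)) ≡⟨ cong (ℚ._* fromℕ (n ^ (n ∸ g))) (a//d*d≡a 1 (n ^ g) {{m^n≢0 n g}}) ⟩
  fromℕ 1 ℚ.* fromℕ (n ^ (n ∸ g))                         ≡⟨ cong (ℚ._* fromℕ (n ^ (n ∸ g))) (ℚ.+-identityʳ 1ℚ) ⟩
  1ℚ ℚ.* fromℕ (n ^ (n ∸ g))                              ≡⟨ ℚ.*-identityˡ _ ⟩
  fromℕ (n ^ (n ∸ g))                                     ∎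
  where open ≡-Reasoning

cλ*nⁿ≡sum : ∀ {m} n .{{_ : NonZero n}} (𝒞s : List (Subset m)) → (∀ {C} → C ∈ₗ 𝒞s → ∣ C ∣ ≤ n) →
            cλ n 𝒞s ℚ.* fromℕ (n ^ n) ≡ fromℕ (sum (map (λ C → n ^ (n ∸ ∣ C ∣)) 𝒞s))
cλ*nⁿ≡sum n []       ∣𝒞s∣≤n = ℚ.*-zeroˡ (fromℕ (n ^ n))
cλ*nⁿ≡sum n (C ∷ 𝒞s) ∣𝒞s∣≤n = begin
  (1 // (n ^ ∣ C ∣) ℚ.+ cλ n 𝒞s) ℚ.* fromℕ (n ^ n)
    ≡⟨ ℚ.*-distribʳ-+ (fromℕ (n ^ n)) (1 // (n ^ ∣ C ∣)) (cλ n 𝒞s) ⟩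
  (1 // (n ^ ∣ C ∣)) ℚ.* fromℕ (n ^ n) ℚ.+ cλ n 𝒞s ℚ.* fromℕ (n ^ n)
    ≡⟨ cong₂ ℚ._+_ (1//nᵍ*nⁿ≡nⁿ⁻ᵍ n (∣𝒞s∣≤n (here refl))) (cλ*nⁿ≡sum n 𝒞s (∣𝒞s∣≤n ∘ there)) ⟩
  fromℕ (n ^ (n ∸ ∣ C ∣)) ℚ.+ fromℕ (sum (map (λ C → n ^ (n ∸ ∣ C ∣)) 𝒞s))
    ≡⟨ sym (fromℕ-+ (n ^ (n ∸ ∣ C ∣)) _) ⟩
  fromℕ (sum (map (λ C → n ^ (n ∸ ∣ C ∣)) (C ∷ 𝒞s))) ∎
  where open ≡-Reasoning

≤1-//-cross : ∀ c {W N rr a} .{{_ : NonZero N}} .{{_ : NonZero a}} →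
              c ℚ.* fromℕ N ≡ fromℕ W → a * W + N * rr ≤ a * N → c ℚ.≤ 1ℚ ℚ.- rr // a
≤1-//-cross c {W} {N} {rr} {a} c*N≡W ≤aN =
  ℚ.*-cancelʳ-≤-pos (N′ ℚ.* a′) {{ℚ.pos*pos⇒pos N′ {{fromℕ-pos N}} a′ {{fromℕ-pos a}}}} (begin
  c ℚ.* (N′ ℚ.* a′)                           ≡⟨ sym (ℚ.*-assoc c N′ a′) ⟩
  (c ℚ.* N′) ℚ.* a′                           ≡⟨ cong (ℚ._* a′) c*N≡W ⟩
  fromℕ W ℚ.* a′                              ≡⟨ ℚ.*-comm (fromℕ W) a′ ⟩
  a′ ℚ.* fromℕ W                              ≡⟨ solve 2 (λ p q → p := (p :+ q) :- q) refl (a′ ℚ.* fromℕ W) (N′ ℚ.* fromℕ rr) ⟩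
  (a′ ℚ.* fromℕ W ℚ.+ N′ ℚ.* fromℕ rr) ℚ.- N′ ℚ.* fromℕ rr
                                              ≤⟨ ℚ.+-monoˡ-≤ (ℚ.- (N′ ℚ.* fromℕ rr)) ℚ-≤aN ⟩
  a′ ℚ.* N′ ℚ.- N′ ℚ.* fromℕ rr                ≡⟨ cong (λ z → a′ ℚ.* N′ ℚ.- N′ ℚ.* z) (sym (a//d*d≡a rr a)) ⟩
  a′ ℚ.* N′ ℚ.- N′ ℚ.* (x ℚ.* a′)              ≡⟨ solve 3 (λ a N x → a :* N :- N :* (x :* a) := (con 1ℚ :- x) :* (N :* a)) refl a′ N′ x ⟩
  (1ℚ ℚ.- x) ℚ.* (N′ ℚ.* a′)                   ∎)
  where
  open ℚ.≤-Reasoning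
  N′ = fromℕ N
  a′ = fromℕ a
  x = rr // a
  ℚ-≤aN : a′ ℚ.* fromℕ W ℚ.+ N′ ℚ.* fromℕ rr ℚ.≤ a′ ℚ.* N′
  ℚ-≤aN = subst₂ ℚ._≤_ (trans (fromℕ-+ (a * W) (N * rr)) (cong₂ ℚ._+_ (fromℕ-* a W) (fromℕ-* N rr))) (fromℕ-* a N)
                (fromℕ-mono-≤ ≤aN)

-- The search tree

module SearchTree {m n l r : ℕ} .{{_ : NonZero n}} {𝓑 : Family m} (u𝓑 : Unique 𝓑) (uniform : Uniform n 𝓑)
         (intersecting : Intersecting 𝓑) (∣𝓑∣≡r : length 𝓑 ≡ r) (lw : LWiseEmpty l 𝓑)
         {𝒞s : List (Subset m)} (enum : Enumerates𝒞 n 𝓑 𝒞s) where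

  private
    𝒞s-minimal : ∀ {C} → C ∈ₗ 𝒞s → IsMinimalCover 𝓑 C
    𝒞s-minimal {C} = proj₁ ∘ Equivalence.to (proj₂ enum C)

    𝒞s-small : ∀ {C} → C ∈ₗ 𝒞s → ∣ C ∣ ≤ n
    𝒞s-small {C} = proj₂ ∘ Equivalence.to (proj₂ enum C)

  D : ℕ
  D = (l ∸ 2) * n

  weight : Subset m → ℕ
  weight C = n ^ (n ∸ ∣ C ∣)

  MeetsAtMostOnce : Subset m → List (Subset m) → Set
  MeetsAtMostOnce C H = All (λ s → ∣ C ∩ s ∣ ≤ 1) H

  meetsAtMostOnce? : ∀ C H → Dec (MeetsAtMostOnce C H)
  meetsAtMostOnce? C H = All.all? (λ s → ∣ C ∩ s ∣ ≤? 1) H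

  ν : Subset m → List (Subset m) → ℕ
  ν C H = 𝟙 (meetsAtMostOnce? C H)

  Ψ : Subset m → List (Subset m) → ℕ
  Ψ X H = sum (map (λ C → 𝟙 (X ⊆? C) * (weight C * suc (ν C H))) 𝒞s)

  ν-antitone : ∀ {X C} H → X ⊆ C → ν C H ≤ ν X H
  ν-antitone {X} {C} H X⊆C = 𝟙-mono (meetsAtMostOnce? C H) (meetsAtMostOnce? X H)
    (All.map λ {s} ∣C∩s∣≤1 → ≤-trans (⊆⇒∣∩∣≤ s X⊆C) ∣C∩s∣≤1)

  ν≡0 : ∀ {C H s} → s ∈ₗ H → 2 ≤ ∣ C ∩ s ∣ → ν C H ≡ 0
  ν≡0 {C} {H} s∈H 1<∣C∩s∣ = 𝟙-no (meetsAtMostOnce? C H) (λ all≤1 → <⇒≱ 1<∣C∩s∣ (All.lookup all≤1 s∈H))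

  ν-∷ : ∀ C B H → ν C (B ∷ H) ≤ ν C H
  ν-∷ C B H = 𝟙-mono (meetsAtMostOnce? C (B ∷ H)) (meetsAtMostOnce? C H) All.tail

  -- If C meets B twice, the two branches through C ∩ B pay for the lost factor two.
  1+ν≤[1+ν-∷]*∣∩∣ : ∀ C B H → 1 ≤ ∣ C ∩ B ∣ → suc (ν C H) ≤ suc (ν C (B ∷ H)) * ∣ C ∩ B ∣
  1+ν≤[1+ν-∷]*∣∩∣ C B H 1≤∣C∩B∣ with ∣ C ∩ B ∣ ≤? 1
  ... | yes ∣C∩B∣≤1 = ≤-trans (s≤s (𝟙-mono (meetsAtMostOnce? C H) (meetsAtMostOnce? C (B ∷ H)) (∣C∩B∣≤1 ∷_)))
                               (m≤m*n _ _ {{>-nonZero 1≤∣C∩B∣}})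
  ... | no  ∣C∩B∣≰1 = ≤-trans (s≤s (𝟙≤1 (meetsAtMostOnce? C H)))
                               (≤-trans (≰⇒> ∣C∩B∣≰1) (m≤n*m _ (suc (ν C (B ∷ H)))))

  Ψ≤∑Ψ : ∀ X H {B} → B ∈ₗ 𝓑 → Ψ X H ≤ ∑[ y ∈ B ] Ψ (X ∪ ⁅ y ⁆) (B ∷ H)
  Ψ≤∑Ψ X H {B} B∈𝓑 = begin
    Ψ X H                                         ≤⟨ sum-map-mono-≤ 𝒞s per-cover ⟩
    sum (map (λ C → ∑[ y ∈ B ] term y C) 𝒞s)     ≡⟨ sym (∑-sum-comm B 𝒞s (λ C y → term y C)) ⟩
    ∑[ y ∈ B ] Ψ (X ∪ ⁅ y ⁆) (B ∷ H)              ∎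
    where
    open ≤-Reasoning
    term : Fin m → Subset m → ℕ
    term y C = 𝟙 (X ∪ ⁅ y ⁆ ⊆? C) * (weight C * suc (ν C (B ∷ H)))
    per-cover : ∀ {C} → C ∈ₗ 𝒞s → 𝟙 (X ⊆? C) * (weight C * suc (ν C H)) ≤ ∑[ y ∈ B ] term y C
    per-cover {C} C∈𝒞s = begin
      𝟙 (X ⊆? C) * (weight C * suc (ν C H))
        ≤⟨ *-monoʳ-≤ (𝟙 (X ⊆? C)) (*-monoʳ-≤ (weight C)
             (1+ν≤[1+ν-∷]*∣∩∣ C B H (Nonempty⇒1≤∣p∣ (proj₁ (𝒞s-minimal C∈𝒞s) B B∈𝓑)))) ⟩
      𝟙 (X ⊆? C) * (weight C * (w′ * ∣ C ∩ B ∣))   ≡⟨ regroup (𝟙 (X ⊆? C)) (weight C) w′ ∣ C ∩ B ∣ ⟩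
      (𝟙 (X ⊆? C) * (weight C * w′)) * ∣ C ∩ B ∣   ≡⟨ cong (𝟙 (X ⊆? C) * (weight C * w′) *_) (∣p∩q∣≡∑𝟙 C B) ⟩
      (𝟙 (X ⊆? C) * (weight C * w′)) * ∑[ y ∈ B ] 𝟙 (y ∈? C)
                                                  ≡⟨ sym (∑-*ˡ B (𝟙 (X ⊆? C) * (weight C * w′)) (λ y → 𝟙 (y ∈? C))) ⟩
      ∑[ y ∈ B ] ((𝟙 (X ⊆? C) * (weight C * w′)) * 𝟙 (y ∈? C))
                                                  ≡⟨ ∑-cong B (λ y → trans (xy∙z≈xz∙y (𝟙 (X ⊆? C)) (weight C * w′) (𝟙 (y ∈? C)))
                                                       (cong (_* (weight C * w′)) (sym (𝟙-× (X ∪ ⁅ y ⁆ ⊆? C) (X ⊆? C) (y ∈? C) p∪⁅x⁆⊆q⇔)))) ⟩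
      ∑[ y ∈ B ] term y C                         ∎
      where
      w′ = suc (ν C (B ∷ H))
      regroup : ∀ a w v c → a * (w * (v * c)) ≡ (a * (w * v)) * c
      regroup = solve-∀

  fall : ℕ → ℕ → ℕ
  fall t k = (D ∸ t) P′ k

  fall-suc : ∀ t k → fall t (suc k) ≡ (D ∸ t) * fall (suc t) k
  fall-suc t k = trans (aP′[1+k]≡a*[a∸1]P′k (D ∸ t) k)
                       (cong (λ e → (D ∸ t) * (e P′ k)) (trans (∸-+-assoc D t 1) (cong (D ∸_) (+-comm t 1))))

  -- As every cover X has r ≤ (l ∸ 1) * ∣ X ∣, this forbids covers with fewer than t + k points.
  Guard : ℕ → ℕ → Set
  Guard t zero    = ⊤
  Guard t (suc k) = (l ∸ 1) * (t + k) < r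

  Guard-child : ∀ t k → Guard t k → Guard (suc t) (pred k)
  Guard-child t zero          _ = tt
  Guard-child t (suc zero)    _ = tt
  Guard-child t (suc (suc k)) g = subst (λ e → (l ∸ 1) * e < r) (+-suc t k) g

  Bound : Subset m → List (Subset m) → ℕ → Set
  Bound X H k = n ^ length H * (D ^ k * Ψ X H) ≤ n ^ n * (D ^ k + ν X H * fall (length H) k)

  record Node (X : Subset m) (H : List (Subset m)) : Set where
    field
      ∣X∣≡∣H∣    : ∣ X ∣ ≡ length H
      H-unique   : Unique H
      H⊆𝓑        : All (_∈ₗ 𝓑) H
      X-covers-H : IsCover H X

  root : Node ⊥ []
  root = record { ∣X∣≡∣H∣ = ∣⊥∣≡0 m ; H-unique = [] ; H⊆𝓑 = [] ; X-covers-H = λ _ () }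

  child : ∀ {X H B} → Node X H → B ∈ₗ 𝓑 → Empty (X ∩ B) → ∀ {y} → y ∈ B → Node (X ∪ ⁅ y ⁆) (B ∷ H)
  child {X} {H} {B} node B∈𝓑 X∩B≡∅ {y} y∈B = record
    { ∣X∣≡∣H∣    = trans (∣p∪⁅x⁆∣≡1+∣p∣ X (Empty[p∩q]⇒x∈q⇒x∉p X∩B≡∅ y∈B)) (cong suc ∣X∣≡∣H∣)
    ; H-unique   = All.tabulate (λ { s∈H refl → X∩B≡∅ (X-covers-H _ s∈H) }) ∷ H-unique
    ; H⊆𝓑        = B∈𝓑 ∷ H⊆𝓑
    ; X-covers-H = λ where
        _ (here refl)  → y , x∈p∩q⁺ (x∈p∪q⁺ (inj₂ (x∈⁅x⁆ y)) , y∈B)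
        s (there s∈H) → let (z , z∈X∩s) = X-covers-H s s∈H
                            (z∈X , z∈s) = x∈p∩q⁻ X s z∈X∩s
                        in z , x∈p∩q⁺ (x∈p∪q⁺ (inj₁ z∈X) , z∈s)
    }
    where open Node node

  r≤[l∸1]*∣X∣ : ∀ {X} → IsCover 𝓑 X → r ≤ (l ∸ 1) * ∣ X ∣
  r≤[l∸1]*∣X∣ {X} X-cover = begin
    r                               ≡⟨ sym ∣𝓑∣≡r ⟩
    length 𝓑                        ≤⟨ length≤sum-map 𝓑 (λ A → ∣ A ∩ X ∣) meets ⟩
    sum (map (λ A → ∣ A ∩ X ∣) 𝓑)   ≡⟨ sym (∑deg≡sum∣∩∣ 𝓑 X) ⟩
    ∑[ y ∈ X ] deg 𝓑 y              ≤⟨ ∑-mono-≤ X (λ {y} _ → m<n⇒m≤n∸1 (deg<l lw u𝓑 (All.tabulate id) y)) ⟩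
    ∑[ _ ∈ X ] (l ∸ 1)              ≡⟨ ∑-const X (l ∸ 1) ⟩
    (l ∸ 1) * ∣ X ∣                 ∎
    where
    open ≤-Reasoning
    meets : ∀ {A} → A ∈ₗ 𝓑 → 1 ≤ ∣ A ∩ X ∣
    meets {A} A∈𝓑 = Nonempty⇒1≤∣p∣ (subst Nonempty (∩-comm X A) (X-cover A A∈𝓑))

  leaf-bound : ∀ {X H} k → IsCover 𝓑 X → Node X H → Guard (length H) k → Bound X H k
  leaf-bound {X} {H} (suc k) X-cover node guard = contradiction guard (≤⇒≯ (begin
    r                         ≤⟨ r≤[l∸1]*∣X∣ X-cover ⟩
    (l ∸ 1) * ∣ X ∣           ≡⟨ cong ((l ∸ 1) *_) (Node.∣X∣≡∣H∣ node) ⟩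
    (l ∸ 1) * length H        ≤⟨ *-monoʳ-≤ (l ∸ 1) (m≤m+n (length H) k) ⟩
    (l ∸ 1) * (length H + k)  ∎))
    where open ≤-Reasoning
  leaf-bound {X} {H} zero X-cover node _ = begin
    n ^ t * (1 * Ψ X H)                                ≡⟨ cong (n ^ t *_) (*-identityˡ (Ψ X H)) ⟩
    n ^ t * Ψ X H                                      ≡⟨ sym (sum-map-*ˡ 𝒞s (n ^ t) _) ⟩
    sum (map (λ C → n ^ t * (𝟙 (X ⊆? C) * f C)) 𝒞s)    ≡⟨ cong sum (map-cong (λ C → x∙yz≈y∙xz (n ^ t) (𝟙 (X ⊆? C)) (f C)) 𝒞s) ⟩
    sum (map (λ C → 𝟙 (X ⊆? C) * (n ^ t * f C)) 𝒞s)    ≤⟨ sum-𝟙*-unique (X ⊆?_) (λ C → n ^ t * f C) (proj₁ enum) only-X X-term ⟩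
    n ^ n * (1 + ν X H * 1)                            ∎
    where
    open ≤-Reasoning
    t = length H
    f : Subset m → ℕ
    f C = weight C * suc (ν C H)
    only-X : ∀ {C} → C ∈ₗ 𝒞s → X ⊆ C → C ≡ X
    only-X C∈𝒞s X⊆C = sym (minimal-cover-⊇-cover⇒≡ (𝒞s-minimal C∈𝒞s) X-cover X⊆C)
    X-term : X ∈ₗ 𝒞s → n ^ t * f X ≤ n ^ n * (1 + ν X H * 1)
    X-term X∈𝒞s = ≤-reflexive (begin-equality
      n ^ t * (n ^ (n ∸ ∣ X ∣) * suc (ν X H))   ≡⟨ sym (*-assoc (n ^ t) _ _) ⟩
      n ^ t * n ^ (n ∸ ∣ X ∣) * suc (ν X H)     ≡⟨ cong (_* suc (ν X H)) (sym (^-distribˡ-+-* n t _)) ⟩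
      n ^ (t + (n ∸ ∣ X ∣)) * suc (ν X H)       ≡⟨ cong (λ e → n ^ (e + (n ∸ ∣ X ∣)) * suc (ν X H)) (sym (Node.∣X∣≡∣H∣ node)) ⟩
      n ^ (∣ X ∣ + (n ∸ ∣ X ∣)) * suc (ν X H)   ≡⟨ cong (λ e → n ^ e * suc (ν X H)) (m+[n∸m]≡n (𝒞s-small X∈𝒞s)) ⟩
      n ^ n * suc (ν X H)                       ≡⟨ cong (λ e → n ^ n * suc e) (sym (*-identityʳ (ν X H))) ⟩
      n ^ n * (1 + ν X H * 1)                   ∎)

  ν-child : ∀ {X H B} → Node X H → Empty (X ∩ B) → ∀ {y} → y ∈ B → ν (X ∪ ⁅ y ⁆) (B ∷ H) ≤ ν X H * (1 ∸ deg H y)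
  ν-child {X} {H} {B} node X∩B≡∅ {y} y∈B with deg H y in deg≡
  ... | zero  = ≤-trans (ν-∷ (X ∪ ⁅ y ⁆) B H)
                  (≤-trans (ν-antitone {X} H (p⊆p∪q ⁅ y ⁆)) (≤-reflexive (sym (*-identityʳ (ν X H)))))
  ... | suc d = ≤-trans (≤-reflexive (ν≡0 {X ∪ ⁅ y ⁆} {B ∷ H} (there s∈H) 1<∣X′∩s∣)) z≤n
    where
    open Node node
    y-in-H = 1≤deg⇒∃∈ H y (subst (1 ≤_) (sym deg≡) (s≤s z≤n))
    s = proj₁ y-in-H
    s∈H = proj₁ (proj₂ y-in-H)
    1<∣X′∩s∣ : 2 ≤ ∣ (X ∪ ⁅ y ⁆) ∩ s ∣
    1<∣X′∩s∣ = subst (2 ≤_) (sym (∣[p∪⁅x⁆]∩q∣≡∣p∩q∣+𝟙 X s (Empty[p∩q]⇒x∈q⇒x∉p X∩B≡∅ y∈B)))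
      (+-mono-≤ (Nonempty⇒1≤∣p∣ (X-covers-H s s∈H)) (≤-reflexive (sym (𝟙-yes (y ∈? s) (proj₂ (proj₂ y-in-H))))))

  -- 1 ∸ d is the indicator of d ≡ 0.
  fresh : List (Subset m) → Subset m → ℕ
  fresh H B = ∑[ y ∈ B ] (1 ∸ deg H y)

  D*fresh≤n*[D∸∣H∣] : ∀ {X H B} → Node X H → B ∈ₗ 𝓑 → Empty (X ∩ B) → D * fresh H B ≤ n * (D ∸ length H)
  D*fresh≤n*[D∸∣H∣] {X} {H} {B} node B∈𝓑 X∩B≡∅ = begin
    (l ∸ 2) * n * fresh H B     ≡⟨ xy∙z≈y∙xz (l ∸ 2) n (fresh H B) ⟩
    n * ((l ∸ 2) * fresh H B)   ≤⟨ *-monoʳ-≤ n (m+n≤o⇒m≤o∸n _ (≤-trans (+-monoʳ-≤ _ ∣H∣≤∑deg) ≤D)) ⟩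
    n * (D ∸ length H)          ∎
    where
    open ≤-Reasoning
    open Node node
    ∣H∣≤∑deg : length H ≤ ∑[ y ∈ B ] deg H y
    ∣H∣≤∑deg = ≤-trans (length≤sum-map H (λ s → ∣ s ∩ B ∣)
                         (λ {s} s∈H → Nonempty⇒1≤∣p∣ (intersecting s B (All.lookup H⊆𝓑 s∈H) B∈𝓑)))
                       (≤-reflexive (sym (∑deg≡sum∣∩∣ H B)))
    deg≤l∸2 : ∀ {y} → y ∈ B → deg H y ≤ l ∸ 2
    deg≤l∸2 {y} y∈B = subst (deg H y ≤_) (∸-+-assoc l 1 1) (m<n⇒m≤n∸1 (m<n⇒m≤n∸1
      (subst (_< l) (cong (_+ deg H y) (𝟙-yes (y ∈? B) y∈B))
        (deg<l lw (Node.H-unique (child node B∈𝓑 X∩B≡∅ y∈B)) (B∈𝓑 ∷ H⊆𝓑) y))))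
    ≤D : (l ∸ 2) * fresh H B + ∑[ y ∈ B ] deg H y ≤ D
    ≤D = begin
      (l ∸ 2) * fresh H B + ∑[ y ∈ B ] deg H y
        ≡⟨ cong (_+ ∑[ y ∈ B ] deg H y) (sym (∑-*ˡ B (l ∸ 2) (λ y → 1 ∸ deg H y))) ⟩
      ∑[ y ∈ B ] ((l ∸ 2) * (1 ∸ deg H y)) + ∑[ y ∈ B ] deg H y
        ≡⟨ sym (∑-distrib-+ B _ _) ⟩
      ∑[ y ∈ B ] ((l ∸ 2) * (1 ∸ deg H y) + deg H y)
        ≤⟨ ∑-mono-≤ B (λ {y} y∈B → c*[1∸d]+d≤c (l ∸ 2) (deg H y) (deg≤l∸2 y∈B)) ⟩
      ∑[ _ ∈ B ] (l ∸ 2)       ≡⟨ ∑-const B (l ∸ 2) ⟩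
      (l ∸ 2) * ∣ B ∣          ≡⟨ cong ((l ∸ 2) *_) (uniform B B∈𝓑) ⟩
      D                        ∎

  branch : ∀ {X H B} → B ∈ₗ 𝓑 → ∀ E →
           n * (n ^ length H * (E * Ψ X H)) ≤ ∑[ y ∈ B ] (n ^ suc (length H) * (E * Ψ (X ∪ ⁅ y ⁆) (B ∷ H)))
  branch {X} {H} {B} B∈𝓑 E = begin
    n * (n ^ t * (E * Ψ X H))                                 ≡⟨ regroup n (n ^ t) E (Ψ X H) ⟩
    (n ^ suc t * E) * Ψ X H                                   ≤⟨ *-monoʳ-≤ (n ^ suc t * E) (Ψ≤∑Ψ X H B∈𝓑) ⟩
    (n ^ suc t * E) * ∑[ y ∈ B ] Ψ (X ∪ ⁅ y ⁆) (B ∷ H)          ≡⟨ sym (∑-*ˡ B (n ^ suc t * E) _) ⟩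
    ∑[ y ∈ B ] ((n ^ suc t * E) * Ψ (X ∪ ⁅ y ⁆) (B ∷ H))        ≡⟨ ∑-cong B (λ y → *-assoc (n ^ suc t) E _) ⟩
    ∑[ y ∈ B ] (n ^ suc t * (E * Ψ (X ∪ ⁅ y ⁆) (B ∷ H)))        ∎
    where
    open ≤-Reasoning
    t = length H
    regroup : ∀ n a E P → n * (a * (E * P)) ≡ (n * a * E) * P
    regroup = solve-∀

  node-bound : ∀ {X H B} k → Node X H → B ∈ₗ 𝓑 → Empty (X ∩ B) →
               (∀ {y} → y ∈ B → Bound (X ∪ ⁅ y ⁆) (B ∷ H) (pred k)) → Bound X H k
  node-bound {X} {H} {B} zero node B∈𝓑 X∩B≡∅ IH = *-cancelˡ-≤ n (begin
    n * (n ^ t * (1 * Ψ X H))                            ≤⟨ branch {X} {H} B∈𝓑 1 ⟩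
    ∑[ y ∈ B ] (n ^ suc t * (1 * Ψ (X ∪ ⁅ y ⁆) (B ∷ H)))  ≤⟨ ∑-mono-≤ B (λ y∈B → ≤-trans (IH y∈B) (child≤ y∈B)) ⟩
    ∑[ _ ∈ B ] (n ^ n * (1 + ν X H * 1))                  ≡⟨ ∑-const B _ ⟩
    n ^ n * (1 + ν X H * 1) * ∣ B ∣                       ≡⟨ cong (n ^ n * (1 + ν X H * 1) *_) (uniform B B∈𝓑) ⟩
    n ^ n * (1 + ν X H * 1) * n                           ≡⟨ *-comm _ n ⟩
    n * (n ^ n * (1 + ν X H * 1))                         ∎)
    where
    open ≤-Reasoning
    t = length H
    child≤ : ∀ {y} → y ∈ B → n ^ n * (1 + ν (X ∪ ⁅ y ⁆) (B ∷ H) * 1) ≤ n ^ n * (1 + ν X H * 1)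
    child≤ {y} y∈B = *-monoʳ-≤ (n ^ n) (+-monoʳ-≤ 1 (*-monoˡ-≤ 1 (≤-trans (ν-child node X∩B≡∅ y∈B)
                       (≤-trans (*-monoʳ-≤ (ν X H) (m∸n≤m 1 (deg H y))) (≤-reflexive (*-identityʳ (ν X H)))))))
  node-bound {X} {H} {B} (suc k) node B∈𝓑 X∩B≡∅ IH = *-cancelˡ-≤ n (begin
    n * (n ^ t * (D ^ suc k * Ψ X H))                       ≤⟨ branch {X} {H} B∈𝓑 (D ^ suc k) ⟩
    ∑[ y ∈ B ] (n ^ suc t * (D * D ^ k * Ψ′ y))             ≡⟨ ∑-cong B (λ y → pull-D (n ^ suc t) D (D ^ k) (Ψ′ y)) ⟩
    ∑[ y ∈ B ] (D * (n ^ suc t * (D ^ k * Ψ′ y)))           ≡⟨ ∑-*ˡ B D _ ⟩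
    D * ∑[ y ∈ B ] (n ^ suc t * (D ^ k * Ψ′ y))             ≤⟨ *-monoʳ-≤ D (∑-mono-≤ B (λ y∈B → ≤-trans (IH y∈B) (child≤ y∈B))) ⟩
    D * ∑[ y ∈ B ] (n ^ n * D ^ k + (n ^ n * ν X H * P) * (1 ∸ deg H y))
                                                            ≡⟨ cong (D *_) (∑-distrib-+ B _ _) ⟩
    D * (∑[ _ ∈ B ] (n ^ n * D ^ k) + ∑[ y ∈ B ] ((n ^ n * ν X H * P) * (1 ∸ deg H y)))
                                                            ≡⟨ cong (D *_) (cong₂ _+_ (trans (∑-const B (n ^ n * D ^ k)) (cong (n ^ n * D ^ k *_) (uniform B B∈𝓑)))
                                                                                      (∑-*ˡ B (n ^ n * ν X H * P) _)) ⟩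
    D * (n ^ n * D ^ k * n + (n ^ n * ν X H * P) * fresh H B) ≡⟨ expand D (n ^ n) (D ^ k) (ν X H) P n (fresh H B) ⟩
    n * (n ^ n * D ^ suc k) + (n ^ n * ν X H * P) * (D * fresh H B)
                                                            ≤⟨ +-monoʳ-≤ _ (*-monoʳ-≤ (n ^ n * ν X H * P) (D*fresh≤n*[D∸∣H∣] node B∈𝓑 X∩B≡∅)) ⟩
    n * (n ^ n * D ^ suc k) + (n ^ n * ν X H * P) * (n * (D ∸ t)) ≡⟨ collect (n ^ n) (D ^ suc k) (ν X H) P n (D ∸ t) ⟩
    n * (n ^ n * (D ^ suc k + ν X H * ((D ∸ t) * P)))       ≡⟨ cong (λ e → n * (n ^ n * (D ^ suc k + ν X H * e))) (sym (fall-suc t k)) ⟩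
    n * (n ^ n * (D ^ suc k + ν X H * fall t (suc k)))      ∎)
    where
    open ≤-Reasoning
    t = length H
    P = fall (suc t) k
    Ψ′ : Fin m → ℕ
    Ψ′ y = Ψ (X ∪ ⁅ y ⁆) (B ∷ H)
    pull-D : ∀ a D E Q → a * (D * E * Q) ≡ D * (a * (E * Q))
    pull-D = solve-∀
    distribute : ∀ N E v f P → N * (E + v * f * P) ≡ N * E + (N * v * P) * f
    distribute = solve-∀
    expand : ∀ D N E v P n Z → D * (N * E * n + (N * v * P) * Z) ≡ n * (N * (D * E)) + (N * v * P) * (D * Z)
    expand = solve-∀
    collect : ∀ N E v P n d → n * (N * E) + (N * v * P) * (n * d) ≡ n * (N * (E + v * (d * P)))
    collect = solve-∀
    child≤ : ∀ {y} → y ∈ B → n ^ n * (D ^ k + ν (X ∪ ⁅ y ⁆) (B ∷ H) * P) ≤ n ^ n * D ^ k + (n ^ n * ν X H * P) * (1 ∸ deg H y)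
    child≤ {y} y∈B = ≤-trans (*-monoʳ-≤ (n ^ n) (+-monoʳ-≤ (D ^ k) (*-monoˡ-≤ P (ν-child node X∩B≡∅ y∈B))))
                             (≤-reflexive (distribute (n ^ n) (D ^ k) (ν X H) (1 ∸ deg H y) P))

  -- The fuel g = m ∸ ∣ X ∣ makes the recursion structural.
  tree-bound : ∀ g {X H} k → ∣ X ∣ + g ≡ m → Node X H → Guard (length H) k → Bound X H k
  tree-bound g {X} {H} k ∣X∣+g≡m node guard with cover⊎missed 𝓑 X | g
  ... | inj₁ X-cover              | _     = leaf-bound k X-cover node guard
  ... | inj₂ (B , B∈𝓑 , X∩B≡∅)   | zero  = contradiction (∣p∣≤n (X ∪ ⁅ y ⁆)) (<⇒≱ (≤-reflexive (sym ∣X∪y∣≡1+m)))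
    where
    B-nonempty = 1≤∣p∣⇒Nonempty (subst (1 ≤_) (sym (uniform B B∈𝓑)) (>-nonZero⁻¹ n))
    y = proj₁ B-nonempty
    ∣X∪y∣≡1+m : ∣ X ∪ ⁅ y ⁆ ∣ ≡ suc m
    ∣X∪y∣≡1+m = trans (∣p∪⁅x⁆∣≡1+∣p∣ X (Empty[p∩q]⇒x∈q⇒x∉p X∩B≡∅ (proj₂ B-nonempty)))
                      (cong suc (trans (sym (+-identityʳ ∣ X ∣)) ∣X∣+g≡m))
  ... | inj₂ (B , B∈𝓑 , X∩B≡∅)   | suc g = node-bound k node B∈𝓑 X∩B≡∅ λ {y} y∈B →
    tree-bound g (pred k)
      (trans (cong (_+ g) (∣p∪⁅x⁆∣≡1+∣p∣ X (Empty[p∩q]⇒x∈q⇒x∉p X∩B≡∅ y∈B))) (trans (sym (+-suc ∣ X ∣ g)) ∣X∣+g≡m))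
      (child node B∈𝓑 X∩B≡∅ y∈B) (Guard-child (length H) k guard)

  root-bound : ∀ k → Guard 0 k → D ^ k * (sum (map weight 𝒞s) * 2) ≤ n ^ n * (D ^ k + (D P′ k))
  root-bound k guard = begin
    D ^ k * (sum (map weight 𝒞s) * 2)  ≡⟨ cong (D ^ k *_) Ψ[⊥,[]]≡2W ⟩
    D ^ k * Ψ ⊥ []                     ≡⟨ sym (*-identityˡ _) ⟩
    1 * (D ^ k * Ψ ⊥ [])               ≤⟨ tree-bound m k (cong (_+ m) (∣⊥∣≡0 m)) root guard ⟩
    n ^ n * (D ^ k + 1 * (D P′ k))     ≡⟨ cong (λ e → n ^ n * (D ^ k + e)) (*-identityˡ (D P′ k)) ⟩
    n ^ n * (D ^ k + (D P′ k))         ∎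
    where
    open ≤-Reasoning
    Ψ[⊥,[]]≡2W : sum (map weight 𝒞s) * 2 ≡ Ψ ⊥ []
    Ψ[⊥,[]]≡2W = begin-equality
      sum (map weight 𝒞s) * 2                         ≡⟨ *-comm (sum (map weight 𝒞s)) 2 ⟩
      2 * sum (map weight 𝒞s)                         ≡⟨ sym (sum-map-*ˡ 𝒞s 2 weight) ⟩
      sum (map (λ C → 2 * weight C) 𝒞s)               ≡⟨ cong sum (map-cong (λ C → trans (*-comm 2 (weight C))
                                                            (sym (trans (cong (_* (weight C * 2)) (𝟙-yes (⊥ ⊆? C) ⊥⊆)) (*-identityˡ _)))) 𝒞s) ⟩
      Ψ ⊥ []                                          ∎

  total-weight-bound : 3 ≤ l → l < r → r * r ≤ l ^ 3 * n →
                       10 * l ^ 3 * n * sum (map weight 𝒞s) + n ^ n * (r * r) ≤ 10 * l ^ 3 * n * n ^ n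
  total-weight-bound 3≤l l<r r²≤l³n =
    trade-for-exponent (2 * D + K * k) W (n ^ n) (K * k) (r * r) (10 * l ^ 3 * n)
      (halve-by-falling-factorial (D ^ K) W (n ^ n) (D P′ K) D (K * k) (root-bound K guard) (aP′k*[2a+k[k∸1]]≤2a*aᵏ D K))
      (constant-10-suffices l n r k 1≤k r≤[l∸1]K r²≤l³n)
    where
    W = sum (map weight 𝒞s)
    depth = choose-depth 3≤l l<r
    k = proj₁ depth
    K = suc k
    1≤k = proj₁ (proj₂ depth)
    guard = proj₁ (proj₂ (proj₂ depth))
    r≤[l∸1]K = proj₂ (proj₂ (proj₂ depth))
    instance
      _ : NonZero (D ^ K)
      _ = m^n≢0 D K {{m*n≢0 (l ∸ 2) n {{>-nonZero (subst (1 ≤_) (∸-+-assoc l 1 1) (m<n⇒m≤n∸1 (m<n⇒m≤n∸1 3≤l)))}}}}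
      _ : NonZero (2 * D + K * k)
      _ = >-nonZero (≤-trans (*-mono-≤ {1} {K} {1} {k} (s≤s z≤n) 1≤k) (m≤n+m (K * k) (2 * D)))

lemma10 : (m n l r : ℕ) → 1 ≤ n → 1 ≤ l → 2 * l ≤ r → r * r ≤ l ^ 3 * n →
          (𝓑 : Family m) → Unique 𝓑 → Uniform n 𝓑 → Intersecting 𝓑 →
          length 𝓑 ≡ r → LWiseEmpty l 𝓑 →
          (𝒞s : List (Subset m)) → Enumerates𝒞 n 𝓑 𝒞s →
          ∀ N → cλ n 𝒞s ℚ.* expPartial ((r * r) // (10 * l ^ 3 * n)) N ℚ.≤ ℚ.1ℚ
lemma10 m n l r 1≤n 1≤l 2l≤r r²≤l³n 𝓑 u𝓑 uniform intersecting ∣𝓑∣≡r lw 𝒞s enum =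
  ≤1-x⇒*expPartial≤1 (0≤a//d (r * r) a) (a//d≤1 a (≤-trans r²≤l³n (*-monoˡ-≤ n (m≤n*m (l ^ 3) 10))))
    (≤1-//-cross (cλ n 𝒞s) {N = n ^ n} {a = a} (cλ*nⁿ≡sum n 𝒞s (proj₂ ∘ Equivalence.to (proj₂ enum _)))
      (SearchTree.total-weight-bound u𝓑 uniform intersecting ∣𝓑∣≡r lw enum 3≤l l<r r²≤l³n))
  where
  a = 10 * l ^ 3 * n
  l<r : l < r
  l<r = <-≤-trans (subst (l <_) (*-comm l 2) (m<m*n l 2 {{>-nonZero 1≤l}} (s≤s (s≤s z≤n)))) 2l≤r
  3≤l : 3 ≤ l
  3≤l = LWiseEmpty⇒3≤l u𝓑 intersecting lw (≤-trans (s≤s 1≤l) (subst (l <_) (sym ∣𝓑∣≡r) l<r))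
  instance
    _ : NonZero n
    _ = >-nonZero 1≤n
    _ : NonZero a
    _ = m*n≢0 (10 * l ^ 3) n {{m*n≢0 10 (l ^ 3) {{_}} {{m^n≢0 l 3 {{>-nonZero 1≤l}}}}}}
    _ : NonZero (n ^ n)
    _ = m^n≢0 n n
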